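{- Let $M=(C,\alpha_0,\alpha_1,\alpha_2)$ be a map, $e=\{c,\alpha_0c,\alpha_2c,\alpha_0\alpha_2c\}$ an edge of $M$, and $a,b$ distinct crosses of $M$ with $\{a,b,\alpha_1a,\alpha_1b\}\cap\{c,\alpha_0c,\alpha_2c,\alpha_0\alpha_2c\}=\emptyset$. Then $(M\backslash e)^{(a\,b)}=M^{(a\,b)}\backslash e$ and $(M/e)^{(a\,b)}=M^{(a\,b)}/e$.
   Context: Maps. A map $M$ is a tuple $(C,\alpha_0,\alpha_1,\alpha_2)$, where $C$ is a finite set (of crosses) and $\alpha_0,\alpha_1,\alpha_2$ are fixed-point-free involutions of $C$ with $\alpha_0\alpha_2=\alpha_2\alpha_0$, together with a finite number (possibly zero) of isolated vertices. Vertex permutation $\tau=\alpha_1\alpha_2$. Vertices: orbits of $\langle\alpha_1,\alpha_2\rangle$ on $C$ plus isolated vertices; edges: orbits of $\langle\alpha_0,\alpha_2\rangle$. The dual is $M^*=(C,\alpha_2,\alpha_1,\alpha_0)$ with the same isolated vertices. Deletion/contraction: $M\backslash e$ removes the four crosses of $e$, restricts $\alpha_0,\alpha_2$, and chooses $\alpha_1$ so that the new vertex permutation cycles are those of $\tau$ with the crosses of $e$ removed (a vertex all of whose crosses lie in $e$ becomes isolated). Contraction is $M/e=(M^*\backslash e)^*$. Riffling: for distinct crosses $a,b$, $M^{(a\,b)}$ is the map $(C,\alpha_0,(a\;b)\alpha_1(a\;b),\alpha_2)$ with the same isolated vertices. -}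

module Defs where

open import Data.Nat using (ℕ; zero; suc; _+_)
open import Data.List using (List; []; _∷_; _++_; map; length; filter; deduplicate)
open import Data.List.Membership.Propositional using (_∈_)
open import Data.List.Membership.DecPropositional using () renaming (_∈?_ to mem?)
open import Data.List.Relation.Unary.All using (All; all?)
open import Data.Sum using (_⊎_; inj₁; inj₂)
open import Data.Product using (_×_; _,_)
open import Data.Empty using (⊥)
open import Function using (_∘_)
open import Relation.Nullary using (¬_; Dec; yes; no)
open import Relation.Nullary.Decidable using (_⊎-dec_)
open import Relation.Binary using (DecidableEquality)
open import Relation.Binary.PropositionalEquality using (_≡_; refl; _≢_; sym; trans; cong)

record PreMap (C : Set) : Set where
  field
    decEq : DecidableEquality C
    elems : List C
    α₀ α₁ α₂ : C → C
    isolated : ℕ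
open PreMap public

record IsMap {C : Set} (M : PreMap C) : Set where
  field
    complete : ∀ x → x ∈ elems M
    invol₀ : ∀ x → α₀ M (α₀ M x) ≡ x
    invol₁ : ∀ x → α₁ M (α₁ M x) ≡ x
    invol₂ : ∀ x → α₂ M (α₂ M x) ≡ x
    fpf₀ : ∀ x → α₀ M x ≢ x
    fpf₁ : ∀ x → α₁ M x ≢ x
    fpf₂ : ∀ x → α₂ M x ≢ x
    comm₀₂ : ∀ x → α₀ M (α₂ M x) ≡ α₂ M (α₀ M x)

τ : {C : Set} → PreMap C → C → C
τ M = α₁ M ∘ α₂ M

InE : {C : Set} (a₀ a₂ : C → C) (c : C) → C → Set
InE a₀ a₂ c x = x ≡ c ⊎ x ≡ a₀ c ⊎ x ≡ a₂ c ⊎ x ≡ a₀ (a₂ c)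

inE? : {C : Set} → DecidableEquality C → (a₀ a₂ : C → C) (c : C) → (x : C) → Dec (InE a₀ a₂ c x)
inE? _≟_ a₀ a₂ c x = (x ≟ c) ⊎-dec ((x ≟ a₀ c) ⊎-dec ((x ≟ a₂ c) ⊎-dec (x ≟ a₀ (a₂ c))))

edgeList : {C : Set} (a₀ a₂ : C → C) (c : C) → List C
edgeList a₀ a₂ c = c ∷ a₀ c ∷ a₂ c ∷ a₀ (a₂ c) ∷ []

-- Crosses not in the edge (irrelevant proof, so equality is equality of val)
record Del {C : Set} (a₀ a₂ : C → C) (c : C) : Set where
  constructor ⟨_,_⟩
  field
    val : C
    .out : ¬ InE a₀ a₂ c val
open Del public

-- In a map, the edge of c for (α₀,α₂) is the same set as for (α₂,α₀)
-- (the edge of c in the dual map).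
flipOut : {C : Set} (a₀ a₂ : C → C) {c x : C} →
          (∀ y → a₀ (a₂ y) ≡ a₂ (a₀ y)) →
          ¬ InE a₀ a₂ c x → ¬ InE a₂ a₀ c x
flipOut _ _ cm h (inj₁ p) = h (inj₁ p)
flipOut _ _ cm h (inj₂ (inj₁ p)) = h (inj₂ (inj₂ (inj₁ p)))
flipOut _ _ cm h (inj₂ (inj₂ (inj₁ p))) = h (inj₂ (inj₁ p))
flipOut _ _ {c = c} cm h (inj₂ (inj₂ (inj₂ p))) = h (inj₂ (inj₂ (inj₂ (trans p (sym (cm c))))))

-- Vertices (orbits of ⟨α₁,α₂⟩), computed by breadth-first closure with
-- fuel |C| (the number of listed crosses), which suffices in a finite set.

closeStep : {C : Set} → PreMap C → List C → List C
closeStep M xs = xs ++ map (α₁ M) xs ++ map (α₂ M) xs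

closeN : {C : Set} → PreMap C → ℕ → List C → List C
closeN M zero xs = xs
closeN M (suc n) xs = closeN M n (closeStep M xs)

vertexOf : {C : Set} → PreMap C → C → List C
vertexOf M y = closeN M (length (elems M)) (y ∷ [])

verticesInsideEdge : {C : Set} → PreMap C → C → ℕ
verticesInsideEdge M c =
  length (deduplicate (λ y z → mem? (decEq M) z (vertexOf M y))
           (filter (λ y → all? (inE? (decEq M) (α₀ M) (α₂ M) c) (vertexOf M y))
                   (edgeList (α₀ M) (α₂ M) c)))

module _ {C : Set} (M : PreMap C) (c : C) where
  private
    D = Del (α₀ M) (α₂ M) c
    dec? = inE? (decEq M) (α₀ M) (α₂ M) c

  delDecEq : DecidableEquality D
  delDecEq ⟨ x , _ ⟩ ⟨ y , _ ⟩ with decEq M x y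
  ... | yes refl = yes refl
  ... | no ne = no (λ { refl → ne refl })

  delElems : List C → List D
  delElems [] = []
  delElems (x ∷ xs) with dec? x
  ... | yes _ = delElems xs
  ... | no p = ⟨ x , p ⟩ ∷ delElems xs

  -- package a cross as an element of C \ e, falling back to d
  -- (the fallback never happens when M is a map)
  pack : C → D → D
  pack y d with dec? y
  ... | yes _ = d
  ... | no p = ⟨ y , p ⟩

  search : ℕ → C → D → D
  search n y d with dec? y
  search n y d | no p = ⟨ y , p ⟩
  search zero y d | yes _ = d
  search (suc n) y d | yes _ = search n (τ M y) d

  -- restricted vertex permutation: cycles of τ with the crosses of e removed
  τDel : D → D
  τDel x = search (length (elems M)) (τ M (val x)) x

  delα₀ delα₂ delα₁ : D → D
  delα₀ x = pack (α₀ M (val x)) x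
  delα₂ x = pack (α₂ M (val x)) x
  -- α₁ chosen so that α₁' α₂' = τ' (α₂' an involution)
  delα₁ x = τDel (delα₂ x)

  delete : PreMap D
  delete = record
    { decEq = delDecEq
    ; elems = delElems (elems M)
    ; α₀ = delα₀
    ; α₁ = delα₁
    ; α₂ = delα₂
    ; isolated = isolated M + verticesInsideEdge M c
    }

dual : {C : Set} → PreMap C → PreMap C
dual M = record
  { decEq = decEq M ; elems = elems M
  ; α₀ = α₂ M ; α₁ = α₁ M ; α₂ = α₀ M ; isolated = isolated M }

contract : {C : Set} (M : PreMap C) (c : C) → PreMap (Del (α₂ M) (α₀ M) c)
contract M c = dual (delete (dual M) c)

swap : {C : Set} → DecidableEquality C → C → C → C → C
swap _≟_ a b x with x ≟ a
... | yes _ = b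
... | no _ with x ≟ b
...   | yes _ = a
...   | no _ = x

riffle : {C : Set} → PreMap C → C → C → PreMap C
riffle M a b = record
  { decEq = decEq M ; elems = elems M
  ; α₀ = α₀ M
  ; α₁ = λ x → swap (decEq M) a b (α₁ M (swap (decEq M) a b x))
  ; α₂ = α₂ M ; isolated = isolated M }

_≈ₘ_ : {C : Set} → PreMap C → PreMap C → Set
M ≈ₘ N = (∀ x → α₀ M x ≡ α₀ N x) × (∀ x → α₁ M x ≡ α₁ N x)
       × (∀ x → α₂ M x ≡ α₂ N x) × (isolated M ≡ isolated N)

-- Riffling by (a b) changes α₁ only at a, b, α₁a, α₁b, all outside e, so on the
-- crosses of e the maps M and M^(a b) have the same α₁, α₂ and τ.  Deletion
-- reads τ on e only: the new vertex cycle after a cross x follows τ from τx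
-- through e to the first cross outside e, and the new isolated vertices are the
-- vertices lying inside e.  Hence both computations agree in M and M^(a b), up
-- to conjugating the resulting α₁ by (a b).  The one point needing care is that
-- the search along τ never runs out of fuel: τ permutes a finite set, so the
-- cycle through a cross outside e returns to it within |C| steps.  Contraction
-- is deletion in the dual, and riffling commutes with duality.
module Submission where

open import Defs
open import Data.Nat using (ℕ; zero; suc; _+_; _≤_; _<_; s≤s)
open import Data.Nat.Properties using (m≤n⇒∃[o]m+o≡n; +-comm; m≤m+n; ≤-trans; ≤-reflexive; n<1+n; <⇒≤)
open import Data.Nat.GeneralisedArithmetic using (iterate)
open import Data.Fin using (Fin; toℕ)
open import Data.Fin.Properties using (pigeonhole; toℕ≤pred[n])
open import Data.List using (List; []; _∷_; _++_; length; filter; deduplicate; lookup)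
open import Data.List.Properties using (filter-≐; map-cong; map-cong-local)
open import Data.List.Relation.Unary.All as All using (All; []; _∷_; all?)
open import Data.List.Relation.Unary.All.Properties using (++⁻ˡ; all-filter)
open import Data.List.Relation.Unary.Any using (index)
open import Data.List.Relation.Unary.Any.Properties using (lookup-index)
open import Data.List.Membership.Propositional using (_∈_)
open import Data.List.Membership.DecPropositional using () renaming (_∈?_ to mem?)
open import Data.Product using (_×_; _,_; ∃-syntax; proj₁; proj₂)
open import Data.Sum using (inj₁; inj₂)
open import Data.Empty using (⊥-elim; ⊥-elim-irr)
open import Function using (_∘_)
open import Function.Definitions using (Injective)
open import Relation.Binary using (Decidable; DecidableEquality)
open import Relation.Nullary using (¬_; Dec; yes; no; ¬?)
open import Relation.Unary using (_≐_)
open import Relation.Binary.PropositionalEquality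
  using (_≡_; _≢_; refl; sym; trans; cong; cong₂; subst; module ≡-Reasoning)

Del-≡ : {C : Set} {a₀ a₂ : C → C} {c : C} {d d' : Del a₀ a₂ c} → val d ≡ val d' → d ≡ d'
Del-≡ {d = ⟨ x , _ ⟩} {⟨ .x , _ ⟩} refl = refl

val-outside : {C : Set} {a₀ a₂ : C → C} {c : C} (d : Del a₀ a₂ c) → ¬ InE a₀ a₂ c (val d)
val-outside ⟨ x , x∉e ⟩ x∈e = ⊥-elim-irr (x∉e x∈e)

InE-a₂ : {C : Set} {a₀ a₂ : C → C} {c x : C} →
         (∀ y → a₂ (a₂ y) ≡ y) → (∀ y → a₀ (a₂ y) ≡ a₂ (a₀ y)) →
         InE a₀ a₂ c x → InE a₀ a₂ c (a₂ x)
InE-a₂ inv cm (inj₁ refl)                 = inj₂ (inj₂ (inj₁ refl))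
InE-a₂ inv cm (inj₂ (inj₁ refl))          = inj₂ (inj₂ (inj₂ (sym (cm _))))
InE-a₂ inv cm (inj₂ (inj₂ (inj₁ refl)))   = inj₁ (inv _)
InE-a₂ {a₀ = a₀} {a₂} {c} inv cm (inj₂ (inj₂ (inj₂ refl))) =
  inj₂ (inj₁ (trans (sym (cm (a₂ c))) (cong a₀ (inv c))))

¬InE-a₂ : {C : Set} {a₀ a₂ : C → C} {c x : C} →
          (∀ y → a₂ (a₂ y) ≡ y) → (∀ y → a₀ (a₂ y) ≡ a₂ (a₀ y)) →
          ¬ InE a₀ a₂ c x → ¬ InE a₀ a₂ c (a₂ x)
¬InE-a₂ {a₀ = a₀} {a₂} {c} inv cm x∉e a₂x∈e =
  x∉e (subst (InE a₀ a₂ c) (inv _) (InE-a₂ inv cm a₂x∈e))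

swap-fixes : {C : Set} (_≟_ : DecidableEquality C) {a b x : C} →
             x ≢ a → x ≢ b → swap _≟_ a b x ≡ x
swap-fixes _≟_ {a} {b} {x} x≢a x≢b with x ≟ a
... | yes x≡a = ⊥-elim (x≢a x≡a)
... | no _ with x ≟ b
...   | yes x≡b = ⊥-elim (x≢b x≡b)
...   | no _ = refl

swap-preserves : {C : Set} (_≟_ : DecidableEquality C) {P : C → Set} {a b x : C} →
                 P a → P b → P x → P (swap _≟_ a b x)
swap-preserves _≟_ {a = a} {b} {x} pa pb px with x ≟ a
... | yes _ = pb
... | no _ with x ≟ b
...   | yes _ = pa
...   | no _ = px

val-swap : {C : Set} (M : PreMap C) (c : C) (x a b : Del (α₀ M) (α₂ M) c) →
           val (swap (delDecEq M c) a b x) ≡ swap (decEq M) (val a) (val b) (val x)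
val-swap M c ⟨ x , _ ⟩ ⟨ a , _ ⟩ ⟨ b , _ ⟩ with decEq M x a
... | yes refl = refl
... | no _ with decEq M x b
...   | yes refl = refl
...   | no _ = refl

iterate-+ : {A : Set} (f : A → A) (x : A) (m n : ℕ) →
            iterate f x (m + n) ≡ iterate f (iterate f x m) n
iterate-+ f x zero    n = refl
iterate-+ f x (suc m) n = iterate-+ f (f x) m n

iterate-injective : {A : Set} {f : A → A} → Injective _≡_ _≡_ f →
                    ∀ n {x y} → iterate f x n ≡ iterate f y n → x ≡ y
iterate-injective inj zero    p = p
iterate-injective inj (suc n) p = inj (iterate-injective inj n p)

-- Pigeonhole on the positions of x, f x, …, fⁿ x in the enumeration, n = |xs|.
iterate-periodic : {A : Set} {f : A → A} → Injective _≡_ _≡_ f →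
                   (xs : List A) → (∀ x → x ∈ xs) →
                   ∀ x → ∃[ o ] o < length xs × iterate f x (suc o) ≡ x
iterate-periodic {A} {f} inj xs complete x = period (pigeonhole (n<1+n (length xs)) position)
  where
  orbit : Fin (suc (length xs)) → A
  orbit k = iterate f x (toℕ k)

  position : Fin (suc (length xs)) → Fin (length xs)
  position k = index (complete (orbit k))

  period : (∃[ i ] ∃[ j ] toℕ i < toℕ j × position i ≡ position j) →
           ∃[ o ] o < length xs × iterate f x (suc o) ≡ x
  period (i , j , i<j , same-position) = o , o<n , sym (iterate-injective inj (toℕ i) cycle)
    where
    open ≡-Reasoning
    o : ℕ
    o = proj₁ (m≤n⇒∃[o]m+o≡n i<j)
    j≡o+i : suc o + toℕ i ≡ toℕ j
    j≡o+i = trans (cong suc (+-comm o (toℕ i))) (proj₂ (m≤n⇒∃[o]m+o≡n i<j))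
    o<n : o < length xs
    o<n = ≤-trans (m≤m+n (suc o) (toℕ i)) (≤-trans (≤-reflexive j≡o+i) (toℕ≤pred[n] j))
    cycle : iterate f x (toℕ i) ≡ iterate f (iterate f x (suc o)) (toℕ i)
    cycle = begin
      orbit i                                   ≡⟨ lookup-index (complete (orbit i)) ⟩
      lookup xs (position i)                    ≡⟨ cong (lookup xs) same-position ⟩
      lookup xs (position j)                    ≡⟨ sym (lookup-index (complete (orbit j))) ⟩
      iterate f x (toℕ j)                       ≡⟨ cong (iterate f x) (sym j≡o+i) ⟩
      iterate f x (suc o + toℕ i)               ≡⟨ iterate-+ f x (suc o) (toℕ i) ⟩
      iterate f (iterate f x (suc o)) (toℕ i)   ∎

τ-injective : {C : Set} {M : PreMap C} → IsMap M → Injective _≡_ _≡_ (τ M)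
τ-injective {M = M} m {x} {y} τx≡τy = begin
  x                         ≡⟨ sym (invol₂ x) ⟩
  α₂ M (α₂ M x)             ≡⟨ cong (α₂ M) (sym (invol₁ (α₂ M x))) ⟩
  α₂ M (α₁ M (τ M x))       ≡⟨ cong (α₂ M ∘ α₁ M) τx≡τy ⟩
  α₂ M (α₁ M (τ M y))       ≡⟨ cong (α₂ M) (invol₁ (α₂ M y)) ⟩
  α₂ M (α₂ M y)             ≡⟨ invol₂ y ⟩
  y                         ∎
  where open IsMap m
        open ≡-Reasoning

dual-isMap : {C : Set} {M : PreMap C} → IsMap M → IsMap (dual M)
dual-isMap m = record
  { complete = complete ; invol₀ = invol₂ ; invol₁ = invol₁ ; invol₂ = invol₀
  ; fpf₀ = fpf₂ ; fpf₁ = fpf₁ ; fpf₂ = fpf₀ ; comm₀₂ = λ x → sym (comm₀₂ x) }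
  where open IsMap m

dual-≈ₘ : {C : Set} {M N : PreMap C} → M ≈ₘ N → dual M ≈ₘ dual N
dual-≈ₘ (eq₀ , eq₁ , eq₂ , eqᵢ) = eq₂ , eq₁ , eq₀ , eqᵢ

closeN-cong : {C : Set} (P Q : PreMap C) (E : C → Set) →
              (∀ x → α₂ P x ≡ α₂ Q x) → (∀ x → E x → α₁ P x ≡ α₁ Q x) →
              ∀ k xs → All E (closeN P k xs) → closeN P k xs ≡ closeN Q k xs
closeN-cong P Q E α₂-eq α₁-eq zero xs _ = refl
closeN-cong P Q E α₂-eq α₁-eq (suc k) xs all-E = begin
  closeN P k (closeStep P xs) ≡⟨ closeN-cong P Q E α₂-eq α₁-eq k (closeStep P xs) all-E ⟩
  closeN Q k (closeStep P xs) ≡⟨ cong (closeN Q k) step-eq ⟩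
  closeN Q k (closeStep Q xs) ∎
  where
  open ≡-Reasoning
  prefix : ∀ k xs → All E (closeN P k xs) → All E xs
  prefix zero    xs h = h
  prefix (suc k) xs h = ++⁻ˡ xs (prefix k (closeStep P xs) h)

  step-eq : closeStep P xs ≡ closeStep Q xs
  step-eq = cong (xs ++_) (cong₂ _++_
    (map-cong-local (All.map (α₁-eq _) (prefix (suc k) xs all-E)))
    (map-cong α₂-eq xs))

deduplicate-cong : {A : Set} {R S : A → A → Set} (R? : Decidable R) (S? : Decidable S) →
                   ∀ {xs} → All (λ x → R x ≐ S x) xs → deduplicate R? xs ≡ deduplicate S? xs
deduplicate-cong R? S? [] = refl
deduplicate-cong {R = R} {S} R? S? {x ∷ xs} (Rx≐Sx ∷ rest) = cong (x ∷_) (begin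
  filter (¬? ∘ R? x) (deduplicate R? xs) ≡⟨ cong (filter (¬? ∘ R? x)) (deduplicate-cong R? S? rest) ⟩
  filter (¬? ∘ R? x) (deduplicate S? xs) ≡⟨ filter-≐ (¬? ∘ R? x) (¬? ∘ S? x) ¬Rx≐¬Sx (deduplicate S? xs) ⟩
  filter (¬? ∘ S? x) (deduplicate S? xs) ∎)
  where
  open ≡-Reasoning
  ¬Rx≐¬Sx : (λ y → ¬ R x y) ≐ (λ y → ¬ S x y)
  ¬Rx≐¬Sx = (λ ¬r s → ¬r (proj₂ Rx≐Sx s)) , (λ ¬s r → ¬s (proj₁ Rx≐Sx r))

module _ {C : Set} (N : PreMap C) (c : C) where
  private
    Edge : C → Set
    Edge = InE (α₀ N) (α₂ N) c

  pack-outside : ∀ y d → ¬ Edge y → val (pack N c y d) ≡ y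
  pack-outside y d y∉e with inE? (decEq N) (α₀ N) (α₂ N) c y
  ... | yes y∈e = ⊥-elim (y∉e y∈e)
  ... | no _ = refl

  search-outside : ∀ n y d → ¬ Edge y → val (search N c n y d) ≡ y
  search-outside n y d y∉e with inE? (decEq N) (α₀ N) (α₂ N) c y
  ... | yes y∈e = ⊥-elim (y∉e y∈e)
  ... | no _ = refl

  search-exit : ∀ n k z → k ≤ n → Edge z → ¬ Edge (iterate (τ N) z k) →
                ∃[ y ] Edge y × (∀ d → val (search N c n z d) ≡ τ N y)
  search-exit n k z k≤n z∈e exit with inE? (decEq N) (α₀ N) (α₂ N) c z
  ... | no z∉e = ⊥-elim (z∉e z∈e)
  search-exit n zero z _ z∈e exit | yes _ = ⊥-elim (exit z∈e)
  search-exit (suc n) (suc k) z (s≤s k≤n) z∈e exit | yes _ =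
    continue (inE? (decEq N) (α₀ N) (α₂ N) c (τ N z))
    where
    continue : Dec (Edge (τ N z)) →
               ∃[ y ] Edge y × (∀ d → val (search N c n (τ N z) d) ≡ τ N y)
    continue (no τz∉e)  = z , z∈e , λ d → search-outside n (τ N z) d τz∉e
    continue (yes τz∈e) = search-exit n k (τ N z) k≤n τz∈e exit

  delα₁-val : (∀ x → α₂ N (α₂ N x) ≡ x) → (∀ {x} → ¬ Edge x → ¬ Edge (α₂ N x)) →
              ∀ u → val (delα₁ N c u)
                    ≡ val (search N c (length (elems N)) (α₁ N (val u)) (delα₂ N c u))
  delα₁-val invol₂ out-α₂ u =
    cong (λ y → val (search N c (length (elems N)) (α₁ N y) (delα₂ N c u)))
      (trans (cong (α₂ N) (pack-outside (α₂ N (val u)) u (out-α₂ (val-outside u))))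
             (invol₂ (val u)))

module _ {C : Set} (M : PreMap C) (c : C) (f : C → C) where
  private
    Edge : C → Set
    Edge = InE (α₀ M) (α₂ M) c

    M' : PreMap C
    M' = record M { α₁ = f }

  pack-α₁-cong : ∀ y d → pack M' c y d ≡ pack M c y d
  pack-α₁-cong y d with inE? (decEq M) (α₀ M) (α₂ M) c y
  ... | yes _ = refl
  ... | no _  = refl

  search-τ-cong : (∀ y → Edge y → τ M' y ≡ τ M y) →
                  ∀ n z d → search M' c n z d ≡ search M c n z d
  search-τ-cong τ-eq n z d with inE? (decEq M) (α₀ M) (α₂ M) c z
  ... | no _ = refl
  search-τ-cong τ-eq zero    z d | yes _   = refl
  search-τ-cong τ-eq (suc n) z d | yes z∈e =
    trans (cong (λ y → search M' c n y d) (τ-eq z z∈e)) (search-τ-cong τ-eq n (τ M z) d)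

  verticesInsideEdge-α₁-cong : (∀ x → Edge x → f x ≡ α₁ M x) →
                               verticesInsideEdge M' c ≡ verticesInsideEdge M c
  verticesInsideEdge-α₁-cong f≈α₁ = cong length (begin
    deduplicate joint' (filter inside' edge) ≡⟨ cong (deduplicate joint') (filter-≐ inside' inside inside'≐inside edge) ⟩
    deduplicate joint' (filter inside edge)  ≡⟨ deduplicate-cong joint' joint (All.map joint'≐joint (all-filter inside edge)) ⟩
    deduplicate joint (filter inside edge)   ∎)
    where
    open ≡-Reasoning
    n : ℕ
    n = length (elems M)

    edge : List C
    edge = edgeList (α₀ M) (α₂ M) c

    inside : ∀ y → Dec (All Edge (vertexOf M y))
    inside y = all? (inE? (decEq M) (α₀ M) (α₂ M) c) (vertexOf M y)

    inside' : ∀ y → Dec (All Edge (vertexOf M' y))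
    inside' y = all? (inE? (decEq M) (α₀ M) (α₂ M) c) (vertexOf M' y)

    joint : ∀ y z → Dec (z ∈ vertexOf M y)
    joint y z = mem? (decEq M) z (vertexOf M y)

    joint' : ∀ y z → Dec (z ∈ vertexOf M' y)
    joint' y z = mem? (decEq M) z (vertexOf M' y)

    vertexOf-cong : ∀ y → All Edge (vertexOf M y) → vertexOf M y ≡ vertexOf M' y
    vertexOf-cong y = closeN-cong M M' Edge (λ _ → refl) (λ x x∈e → sym (f≈α₁ x x∈e)) n (y ∷ [])

    vertexOf-cong' : ∀ y → All Edge (vertexOf M' y) → vertexOf M' y ≡ vertexOf M y
    vertexOf-cong' y = closeN-cong M' M Edge (λ _ → refl) f≈α₁ n (y ∷ [])

    inside'≐inside : (λ y → All Edge (vertexOf M' y)) ≐ (λ y → All Edge (vertexOf M y))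
    inside'≐inside = (λ {y} h → subst (All Edge) (vertexOf-cong' y h) h)
                   , (λ {y} h → subst (All Edge) (vertexOf-cong y h) h)

    joint'≐joint : ∀ {y} → All Edge (vertexOf M y) → (_∈ vertexOf M' y) ≐ (_∈ vertexOf M y)
    joint'≐joint {y} h = (λ {z} → subst (z ∈_) (sym (vertexOf-cong y h)))
                       , (λ {z} → subst (z ∈_) (vertexOf-cong y h))

module _ {C : Set} (M : PreMap C) (isMap : IsMap M) {c a b : C}
         (a∉e : ¬ InE (α₀ M) (α₂ M) c a) (b∉e : ¬ InE (α₀ M) (α₂ M) c b)
         (α₁a∉e : ¬ InE (α₀ M) (α₂ M) c (α₁ M a)) (α₁b∉e : ¬ InE (α₀ M) (α₂ M) c (α₁ M b))
         where
  open IsMap isMap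
  open ≡-Reasoning
  private
    Edge : C → Set
    Edge = InE (α₀ M) (α₂ M) c

    s : C → C
    s = swap (decEq M) a b

    n : ℕ
    n = length (elems M)

    edge-α₂ : ∀ {x} → Edge x → Edge (α₂ M x)
    edge-α₂ = InE-a₂ invol₂ comm₀₂

    out-α₂ : ∀ {x} → ¬ Edge x → ¬ Edge (α₂ M x)
    out-α₂ = ¬InE-a₂ invol₂ comm₀₂

  swap-fixes-edge : ∀ {x} → Edge x → s x ≡ x
  swap-fixes-edge x∈e = swap-fixes (decEq M) (λ { refl → a∉e x∈e }) (λ { refl → b∉e x∈e })

  swap-fixes-α₁-edge : ∀ {x} → Edge x → s (α₁ M x) ≡ α₁ M x
  swap-fixes-α₁-edge {x} x∈e = swap-fixes (decEq M) (α₁x≢ α₁a∉e) (α₁x≢ α₁b∉e)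
    where
    α₁x≢ : ∀ {p} → ¬ Edge (α₁ M p) → α₁ M x ≢ p
    α₁x≢ α₁p∉e refl = α₁p∉e (subst Edge (sym (invol₁ x)) x∈e)

  riffle-α₁-edge : ∀ x → Edge x → α₁ (riffle M a b) x ≡ α₁ M x
  riffle-α₁-edge x x∈e = trans (cong (s ∘ α₁ M) (swap-fixes-edge x∈e)) (swap-fixes-α₁-edge x∈e)

  riffle-τ-edge : ∀ y → Edge y → τ (riffle M a b) y ≡ τ M y
  riffle-τ-edge y y∈e = riffle-α₁-edge (α₂ M y) (edge-α₂ y∈e)

  -- α₁ u = τ (α₂ u), and the τ-cycle of α₂ u ∉ e returns to it within n steps.
  α₁-orbit-exits-edge : ∀ {u} → ¬ Edge u → ∃[ o ] o < n × ¬ Edge (iterate (τ M) (α₁ M u) o)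
  α₁-orbit-exits-edge {u} u∉e with iterate-periodic (τ-injective isMap) (elems M) complete (α₂ M u)
  ... | o , o<n , period = o , o<n ,
    subst (λ y → ¬ Edge (iterate (τ M) y o)) (cong (α₁ M) (invol₂ u))
          (subst (λ y → ¬ Edge y) (sym period) (out-α₂ u∉e))

  swap-search : ∀ {u} → ¬ Edge u → ∀ d d' →
                s (val (search M c n (α₁ M u) d)) ≡ val (search M c n (s (α₁ M u)) d')
  swap-search {u} u∉e d d' = by-cases (inE? (decEq M) (α₀ M) (α₂ M) c (α₁ M u))
    where
    y : C
    y = α₁ M u

    by-cases : Dec (Edge y) → s (val (search M c n y d)) ≡ val (search M c n (s y) d')
    by-cases (no y∉e) = begin
      s (val (search M c n y d))     ≡⟨ cong s (search-outside M c n y d y∉e) ⟩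
      s y                            ≡⟨ sym (search-outside M c n (s y) d' (swap-preserves (decEq M) {λ z → ¬ Edge z} a∉e b∉e y∉e)) ⟩
      val (search M c n (s y) d')    ∎
    by-cases (yes y∈e) with α₁-orbit-exits-edge u∉e
    ... | o , o<n , exit with search-exit M c n o y (<⇒≤ o<n) y∈e exit
    ...   | x , x∈e , found = begin
      s (val (search M c n y d))     ≡⟨ cong s (found d) ⟩
      s (τ M x)                      ≡⟨ swap-fixes-α₁-edge (edge-α₂ x∈e) ⟩
      τ M x                          ≡⟨ sym (found d') ⟩
      val (search M c n y d')        ≡⟨ cong (λ t → val (search M c n t d')) (sym (swap-fixes-edge y∈e)) ⟩
      val (search M c n (s y) d')    ∎

  riffle-delete-α₁ : ∀ x → α₁ (riffle (delete M c) ⟨ a , a∉e ⟩ ⟨ b , b∉e ⟩) x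
                           ≡ α₁ (delete (riffle M a b) c) x
  riffle-delete-α₁ x = Del-≡ (begin
    val (swap (delDecEq M c) A B (delα₁ M c u))       ≡⟨ val-swap M c (delα₁ M c u) A B ⟩
    s (val (delα₁ M c u))                             ≡⟨ cong s (delα₁-val M c invol₂ out-α₂ u) ⟩
    s (val (search M c n (α₁ M (val u)) (delα₂ M c u))) ≡⟨ swap-search (val-outside u) _ d ⟩
    val (search M c n (s (α₁ M (val u))) d)           ≡⟨ cong (λ y → val (search M c n (s (α₁ M y)) d)) (val-swap M c x A B) ⟩
    val (search M c n (α₁ M' (val x)) d)              ≡⟨ cong val (sym (search-τ-cong M c (α₁ M') riffle-τ-edge n _ d)) ⟩
    val (search M' c n (α₁ M' (val x)) d)             ≡⟨ sym (delα₁-val M' c invol₂ out-α₂ x) ⟩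
    val (delα₁ M' c x)                                ∎)
    where
    M' : PreMap C
    M' = riffle M a b

    A B u d : Del (α₀ M) (α₂ M) c
    A = ⟨ a , a∉e ⟩
    B = ⟨ b , b∉e ⟩
    u = swap (delDecEq M c) A B x
    d = delα₂ M' c x

  riffle-delete : riffle (delete M c) ⟨ a , a∉e ⟩ ⟨ b , b∉e ⟩ ≈ₘ delete (riffle M a b) c
  riffle-delete =
      (λ x → sym (pack-α₁-cong M c (α₁ (riffle M a b)) (α₀ M (val x)) x))
    , riffle-delete-α₁
    , (λ x → sym (pack-α₁-cong M c (α₁ (riffle M a b)) (α₂ M (val x)) x))
    , cong (isolated M +_) (sym (verticesInsideEdge-α₁-cong M c (α₁ (riffle M a b)) riffle-α₁-edge))

lemma3p4 : {C : Set} (M : PreMap C) (isMap : IsMap M) (c a b : C) →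
    a ≢ b →
    (ha : ¬ InE (α₀ M) (α₂ M) c a) → (hb : ¬ InE (α₀ M) (α₂ M) c b) →
    ¬ InE (α₀ M) (α₂ M) c (α₁ M a) → ¬ InE (α₀ M) (α₂ M) c (α₁ M b) →
    (riffle (delete M c) ⟨ a , ha ⟩ ⟨ b , hb ⟩ ≈ₘ delete (riffle M a b) c)
    × (riffle (contract M c) ⟨ a , flipOut (α₀ M) (α₂ M) (IsMap.comm₀₂ isMap) ha ⟩ ⟨ b , flipOut (α₀ M) (α₂ M) (IsMap.comm₀₂ isMap) hb ⟩
    ≈ₘ contract (riffle M a b) c)
lemma3p4 M isMap c a b _ ha hb ha1 hb1 =
    riffle-delete M isMap ha hb ha1 hb1
  , dual-≈ₘ {M = riffle (delete (dual M) c) ⟨ a , flip ha ⟩ ⟨ b , flip hb ⟩}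
             {N = delete (riffle (dual M) a b) c}
             (riffle-delete (dual M) (dual-isMap isMap) (flip ha) (flip hb) (flip ha1) (flip hb1))
  where
  flip : ∀ {x} → ¬ InE (α₀ M) (α₂ M) c x → ¬ InE (α₂ M) (α₀ M) c x
  flip = flipOut (α₀ M) (α₂ M) (IsMap.comm₀₂ isMap)
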